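{- Let $G$ be a finite group and $H\leq A\leq G$ such that $H$ is not normal in $G$. Suppose that $H$ is a perfect code of $G$. If $H^G\leq A\leq \mathrm{N}_G(H)$, then $A$ is not a perfect code of the pair $(G,H)$.
   Context: $H^G$ denotes the normal closure of $H$ in $G$ and $\mathrm{N}_G(H)$ the normalizer. Graphs are finite, undirected and simple; a subset $C$ of the vertex set $V$ of a graph is a perfect code if every vertex in $V\setminus C$ is adjacent to exactly one vertex of $C$. For an inverse-closed $S\subseteq G\setminus\{e\}$, $\mathrm{Cay}(G,S)$ has vertex set $G$ and edges $\{g,sg\}$ ($s\in S$, $g\in G$); a subset of $G$ is a perfect code of $G$ if it is a perfect code in some Cayley graph of $G$. For an inverse-closed $U\subseteq G\setminus H$, the coset graph $\mathrm{Cos}(G,H,U)$ has vertices the left cosets of $H$ in $G$, with $xH$, $yH$ adjacent iff $x^{ -1}y\in HUH$. A subgroup $A$ with $H\leq A\leq G$ is a perfect code of the pair $(G,H)$ if for some such $U$ the set of left cosets of $H$ contained in $A$ is a perfect code in $\mathrm{Cos}(G,H,U)$. -}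

module Defs where

open import Level using (0ℓ)
open import Algebra.Bundles using (Group)
open import Data.List using (List)
open import Data.List.Relation.Unary.Any using (Any)
open import Data.Product using (Σ; _×_; ∃; ∃-syntax)
open import Relation.Nullary using (¬_)

record FiniteGroup : Set₁ where
  field
    group : Group 0ℓ 0ℓ
  open Group group public
  field
    elements : List Carrier
    complete : ∀ x → Any (x ≈_) elements

module _ (G : FiniteGroup) where
  open FiniteGroup G

  Subset : Set₁
  Subset = Carrier → Set

  Respects≈ : Subset → Set
  Respects≈ P = ∀ {x y} → x ≈ y → P x → P y

  _⊆_ : Subset → Subset → Set
  P ⊆ Q = ∀ x → P x → Q x

  record IsSubgroup (H : Subset) : Set where
    field
      resp   : Respects≈ H
      has-ε  : H ε
      closed : ∀ {x y} → H x → H y → H (x ∙ y)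
      inv    : ∀ {x} → H x → H (x ⁻¹)

  IsNormal : Subset → Set
  IsNormal H = ∀ g h → H h → H (g ∙ h ∙ g ⁻¹)

  data NormalClosure (H : Subset) : Subset where
    conj  : ∀ g h → H h → NormalClosure H (g ∙ h ∙ g ⁻¹)
    nc-ε  : NormalClosure H ε
    nc-∙  : ∀ {x y} → NormalClosure H x → NormalClosure H y → NormalClosure H (x ∙ y)
    nc-⁻¹ : ∀ {x} → NormalClosure H x → NormalClosure H (x ⁻¹)
    nc-≈  : ∀ {x y} → x ≈ y → NormalClosure H x → NormalClosure H y

  Normalizer : Subset → Subset
  Normalizer H g = ∀ h → (H h → H (g ∙ h ∙ g ⁻¹)) × (H (g ∙ h ∙ g ⁻¹) → H h)

  record ConnectionSet (S : Subset) (Forbidden : Subset) : Set where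
    field
      resp     : Respects≈ S
      inv-cl   : ∀ {s} → S s → S (s ⁻¹)
      avoids   : ∀ {s} → S s → ¬ Forbidden s

  Identity : Subset
  Identity x = x ≈ ε

  -- adjacency in Cay(G,S): edges {g, s g}, i.e. g ~ k iff k g⁻¹ ∈ S
  CayAdj : Subset → Carrier → Carrier → Set
  CayAdj S g k = S (k ∙ g ⁻¹)

  IsPerfectCodeCay : Subset → Subset → Set
  IsPerfectCodeCay S C =
    ∀ v → ¬ C v →
      (∃[ c ] (C c × CayAdj S v c)) ×
      (∀ c c' → C c → CayAdj S v c → C c' → CayAdj S v c' → c ≈ c')

  PerfectCodeOfGroup : Subset → Set₁
  PerfectCodeOfGroup C =
    Σ Subset λ S → ConnectionSet S Identity × IsPerfectCodeCay S C

  HUH : Subset → Subset → Subset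
  HUH H U z = ∃[ h₁ ] ∃[ u ] ∃[ h₂ ] (H h₁ × U u × H h₂ × z ≈ h₁ ∙ u ∙ h₂)

  -- Cos(G,H,U): vertices are left cosets xH, represented by x;
  -- xH and yH are the same vertex iff x⁻¹y ∈ H;
  -- xH ~ yH iff x⁻¹ y ∈ HUH
  SameCoset : Subset → Carrier → Carrier → Set
  SameCoset H x y = H (x ⁻¹ ∙ y)

  CosAdj : Subset → Subset → Carrier → Carrier → Set
  CosAdj H U x y = HUH H U (x ⁻¹ ∙ y)

  CosetIn : Subset → Subset → Carrier → Set
  CosetIn H A x = ∀ h → H h → A (x ∙ h)

  -- the set of left cosets of H contained in A is a perfect code in Cos(G,H,U)
  IsPerfectCodeCos : Subset → Subset → Subset → Set
  IsPerfectCodeCos H U A =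
    ∀ x → ¬ CosetIn H A x →
      (∃[ y ] (CosetIn H A y × CosAdj H U x y)) ×
      (∀ y y' → CosetIn H A y → CosAdj H U x y →
                CosetIn H A y' → CosAdj H U x y' → SameCoset H y y')

  PerfectCodeOfPair : Subset → Subset → Set₁
  PerfectCodeOfPair H A =
    Σ Subset λ U → ConnectionSet U H × IsPerfectCodeCos H U A

{-# OPTIONS --safe #-}
-- Let U witness that A is a perfect code of (G, H) and take x ∉ A. The coset xH is
-- then outside the code, so it has a neighbour inside: some u ∈ U has xu ∈ A. As
-- H^G ≤ A, every coset x h u H (h ∈ H) also lies in A and is adjacent to xH, so
-- uniqueness of the code neighbour gives u⁻¹ h u ∈ H. Since xu ∈ A ≤ N_G(H), the
-- element x = (xu) u⁻¹ normalises H. Elements of A normalise H by assumption, so H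
-- would be normal. Membership in A need not be decidable, so this case split is
-- made under a double negation, which commutes with ∀ because G is finite.
module Submission where

open import Data.List.Relation.Unary.All as All using ()
open import Data.Product using (_,_; proj₁; proj₂; _×_; ∃-syntax)
open import Level using (0ℓ)
open import Relation.Nullary using (¬_; Dec; yes; no)
open import Relation.Nullary.Decidable using (¬¬-excluded-middle)
open import Relation.Nullary.Negation using (¬¬-Monad; ¬¬-map)

open import Defs

module _ (G : FiniteGroup) where
  open FiniteGroup G
  open import Algebra.Properties.Group group
  open import Relation.Binary.Reasoning.Setoid setoid

  ¬¬-universal : {P : Subset G} → Respects≈ G P →
                 (∀ x → ¬ ¬ P x) → ¬ ¬ (∀ x → P x)
  ¬¬-universal resp ¬¬P =
    ¬¬-map (λ Ps x → All.lookupₛ setoid resp Ps (complete x))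
           (All.sequenceM 0ℓ ¬¬-Monad (All.tabulate (λ {x} _ → ¬¬P x)))

  Normalizes : Subset G → Carrier → Set
  Normalizes H g = ∀ h → H h → H (g ∙ h ∙ g ⁻¹)

  conj-∙ : ∀ w v h → w ∙ v ∙ h ∙ (w ∙ v) ⁻¹ ≈ w ∙ (v ∙ h ∙ v ⁻¹) ∙ w ⁻¹
  conj-∙ w v h = begin
    w ∙ v ∙ h ∙ (w ∙ v) ⁻¹          ≈⟨ ∙-congˡ (⁻¹-anti-homo-∙ w v) ⟩
    w ∙ v ∙ h ∙ (v ⁻¹ ∙ w ⁻¹)        ≈⟨ assoc (w ∙ v ∙ h) (v ⁻¹) (w ⁻¹) ⟨
    w ∙ v ∙ h ∙ v ⁻¹ ∙ w ⁻¹          ≈⟨ ∙-congʳ (∙-congʳ (assoc w v h)) ⟩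
    w ∙ (v ∙ h) ∙ v ⁻¹ ∙ w ⁻¹        ≈⟨ ∙-congʳ (assoc w (v ∙ h) (v ⁻¹)) ⟩
    w ∙ (v ∙ h ∙ v ⁻¹) ∙ w ⁻¹        ∎

  [x∙a]⁻¹∙[x∙b]≈a⁻¹∙b : ∀ x a b → (x ∙ a) ⁻¹ ∙ (x ∙ b) ≈ a ⁻¹ ∙ b
  [x∙a]⁻¹∙[x∙b]≈a⁻¹∙b x a b = begin
    (x ∙ a) ⁻¹ ∙ (x ∙ b)            ≈⟨ ∙-congʳ (⁻¹-anti-homo-∙ x a) ⟩
    a ⁻¹ ∙ x ⁻¹ ∙ (x ∙ b)           ≈⟨ assoc (a ⁻¹) (x ⁻¹) (x ∙ b) ⟩
    a ⁻¹ ∙ (x ⁻¹ ∙ (x ∙ b))         ≈⟨ ∙-congˡ (\\-leftDividesʳ x b) ⟩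
    a ⁻¹ ∙ b                        ∎

  module _ {H : Subset G} (H-resp : Respects≈ G H) where

    normalizes-resp : Respects≈ G (Normalizes H)
    normalizes-resp g≈g′ g-norm h h∈H =
      H-resp (∙-cong (∙-congʳ g≈g′) (⁻¹-cong g≈g′)) (g-norm h h∈H)

    normalizes-∙ : ∀ {w v} → Normalizes H w → Normalizes H v → Normalizes H (w ∙ v)
    normalizes-∙ {w} {v} w-norm v-norm h h∈H =
      H-resp (sym (conj-∙ w v h)) (w-norm _ (v-norm h h∈H))

  module _ {A : Subset G} (sA : IsSubgroup G A) where
    private module A = IsSubgroup sA

    ∈-cancelʳ : ∀ {x a} → A (x ∙ a) → A a → A x
    ∈-cancelʳ {x} {a} xa∈A a∈A = A.resp (//-rightDividesʳ a x) (A.closed xa∈A (A.inv a∈A))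

  normalizer⇒normalizes : ∀ {H g} → Normalizer G H g → Normalizes H g
  normalizer⇒normalizes g∈N h = proj₁ (g∈N h)

  module _ {H A : Subset G} (sH : IsSubgroup G H) (sA : IsSubgroup G A) where
    private
      module H = IsSubgroup sH
      module A = IsSubgroup sA

    cosetIn⇒∈ : ∀ {x} → CosetIn G H A x → A x
    cosetIn⇒∈ {x} xH⊆A = A.resp (identityʳ x) (xH⊆A ε H.has-ε)

    module _ (H⊆A : _⊆_ G H A) where

      ∈⇒cosetIn : ∀ {x} → A x → CosetIn G H A x
      ∈⇒cosetIn x∈A h h∈H = A.closed x∈A (H⊆A h h∈H)

      module _ (H^G⊆A : _⊆_ G (NormalClosure G H) A) where

        ∙-conj-∈ : ∀ {x h z} → H h → A (x ∙ z) → A (x ∙ (h ∙ z))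
        ∙-conj-∈ {x} {h} {z} h∈H xz∈A =
          A.resp x∙h∙x⁻¹∙[x∙z]≈x∙[h∙z] (A.closed (H^G⊆A _ (conj x h h∈H)) xz∈A)
          where
          x∙h∙x⁻¹∙[x∙z]≈x∙[h∙z] : x ∙ h ∙ x ⁻¹ ∙ (x ∙ z) ≈ x ∙ (h ∙ z)
          x∙h∙x⁻¹∙[x∙z]≈x∙[h∙z] = begin
            x ∙ h ∙ x ⁻¹ ∙ (x ∙ z)      ≈⟨ assoc (x ∙ h) (x ⁻¹) (x ∙ z) ⟩
            x ∙ h ∙ (x ⁻¹ ∙ (x ∙ z))    ≈⟨ ∙-congˡ (\\-leftDividesʳ x z) ⟩
            x ∙ h ∙ z                   ≈⟨ assoc x h z ⟩
            x ∙ (h ∙ z)                 ∎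

        module _ {U : Subset G} (pc : IsPerfectCodeCos G H U A)
                 {x : Carrier} (x∉A : ¬ A x) where

          xH⊄A : ¬ CosetIn G H A x
          xH⊄A xH⊆A = x∉A (cosetIn⇒∈ xH⊆A)

          ∃-generator-into-A : ∃[ u ] (U u × A (x ∙ u))
          ∃-generator-into-A with proj₁ (pc x xH⊄A)
          ... | y , yH⊆A , h₁ , u , h₂ , h₁∈H , u∈U , h₂∈H , x⁻¹y≈h₁uh₂ =
            u , u∈U , A.resp (∙-congˡ (\\-leftDividesʳ h₁ u)) (∙-conj-∈ (H.inv h₁∈H) xh₁u∈A)
            where
            y≈xh₁u∙h₂ : y ≈ x ∙ (h₁ ∙ u) ∙ h₂
            y≈xh₁u∙h₂ = begin
              y                         ≈⟨ \\-leftDividesˡ x y ⟨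
              x ∙ (x ⁻¹ ∙ y)            ≈⟨ ∙-congˡ x⁻¹y≈h₁uh₂ ⟩
              x ∙ (h₁ ∙ u ∙ h₂)         ≈⟨ assoc x (h₁ ∙ u) h₂ ⟨
              x ∙ (h₁ ∙ u) ∙ h₂         ∎

            xh₁u∈A : A (x ∙ (h₁ ∙ u))
            xh₁u∈A = ∈-cancelʳ sA (A.resp y≈xh₁u∙h₂ (cosetIn⇒∈ yH⊆A)) (H⊆A h₂ h₂∈H)

          xhuH-neighbour : ∀ {u h} → U u → A (x ∙ u) → H h →
                           CosetIn G H A (x ∙ (h ∙ u)) × CosAdj G H U x (x ∙ (h ∙ u))
          xhuH-neighbour {u} {h} u∈U xu∈A h∈H =
            ∈⇒cosetIn (∙-conj-∈ h∈H xu∈A) ,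
            h , u , ε , h∈H , u∈U , H.has-ε ,
            trans (\\-leftDividesʳ x (h ∙ u)) (sym (identityʳ (h ∙ u)))

          xhuH-sameCoset : ∀ {u h h′} → U u → A (x ∙ u) → H h → H h′ →
                           SameCoset G H (x ∙ (h ∙ u)) (x ∙ (h′ ∙ u))
          xhuH-sameCoset u∈U xu∈A h∈H h′∈H =
            let (xhuH⊆A , xhuH-adj) = xhuH-neighbour u∈U xu∈A h∈H
                (xh′uH⊆A , xh′uH-adj) = xhuH-neighbour u∈U xu∈A h′∈H
            in proj₂ (pc x xH⊄A) _ _ xhuH⊆A xhuH-adj xh′uH⊆A xh′uH-adj

          generator⁻¹-normalizes : ∀ {u} → U u → A (x ∙ u) → Normalizes H (u ⁻¹)
          generator⁻¹-normalizes {u} u∈U xu∈A h h∈H =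
            H.resp [x∙[ε∙u]]⁻¹∙[x∙[h∙u]]≈u⁻¹∙h∙u⁻¹⁻¹
              (xhuH-sameCoset u∈U xu∈A H.has-ε h∈H)
            where
            [x∙[ε∙u]]⁻¹∙[x∙[h∙u]]≈u⁻¹∙h∙u⁻¹⁻¹ :
              (x ∙ (ε ∙ u)) ⁻¹ ∙ (x ∙ (h ∙ u)) ≈ u ⁻¹ ∙ h ∙ u ⁻¹ ⁻¹
            [x∙[ε∙u]]⁻¹∙[x∙[h∙u]]≈u⁻¹∙h∙u⁻¹⁻¹ = begin
              (x ∙ (ε ∙ u)) ⁻¹ ∙ (x ∙ (h ∙ u))  ≈⟨ [x∙a]⁻¹∙[x∙b]≈a⁻¹∙b x (ε ∙ u) (h ∙ u) ⟩
              (ε ∙ u) ⁻¹ ∙ (h ∙ u)              ≈⟨ ∙-congʳ (⁻¹-cong (identityˡ u)) ⟩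
              u ⁻¹ ∙ (h ∙ u)                    ≈⟨ assoc (u ⁻¹) h u ⟨
              u ⁻¹ ∙ h ∙ u                      ≈⟨ ∙-congˡ (⁻¹-involutive u) ⟨
              u ⁻¹ ∙ h ∙ u ⁻¹ ⁻¹                ∎

          ∉⇒normalizes : _⊆_ G A (Normalizer G H) → Normalizes H x
          ∉⇒normalizes A⊆N with ∃-generator-into-A
          ... | u , u∈U , xu∈A =
            normalizes-resp H.resp (//-rightDividesʳ u x)
              (normalizes-∙ H.resp (normalizer⇒normalizes (A⊆N _ xu∈A))
                                   (generator⁻¹-normalizes u∈U xu∈A))

        ¬¬-normalizes : _⊆_ G A (Normalizer G H) → ∀ {U} → IsPerfectCodeCos G H U A →
                        ∀ x → ¬ ¬ Normalizes H x
        ¬¬-normalizes A⊆N pc x = ¬¬-map normalizes ¬¬-excluded-middle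
          where
          normalizes : Dec (A x) → Normalizes H x
          normalizes (yes x∈A) = normalizer⇒normalizes (A⊆N x x∈A)
          normalizes (no x∉A) = ∉⇒normalizes pc x∉A A⊆N

proposition1p8 : (G : FiniteGroup) (H A : Subset G) →
    IsSubgroup G H → IsSubgroup G A → _⊆_ G H A → ¬ IsNormal G H →
    PerfectCodeOfGroup G H →
    _⊆_ G (NormalClosure G H) A → _⊆_ G A (Normalizer G H) →
    ¬ PerfectCodeOfPair G H A
proposition1p8 G H A sH sA H⊆A H-not-normal _ H^G⊆A A⊆N (U , _ , pc) =
  ¬¬-universal G (normalizes-resp G (IsSubgroup.resp sH))
    (¬¬-normalizes G sH sA H⊆A H^G⊆A A⊆N pc) H-not-normal
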